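{- The rewrite system $R(\hat{\mathcal F}_\iota)$, obtained by orienting from left to right the defining equations of all defined $\iota$-function symbols, is a canonical (terminating and confluent) rewrite system.
   Context: Two-sorted setting. Sort $\omega$: numerals $\bar 0,s(\bar 0),\dots$; parameters are variables of sort $\omega$; $\omega$-terms $T^\omega$ are built from $\bar 0$, parameters, $s$ and defined numeric function symbols given by primitive recursive defining equations (so that under any assignment $\sigma$ of numerals to parameters every $\omega$-term $t$ has a numeral normal form $\sigma(t){\downarrow_\omega}$). Sort $\iota$: global variables $X$ of type $\omega^\gamma\to\iota$ ($\gamma\ge0$); a V-term is $X(t_1,\dots,t_\gamma)$ with $t_i\in T^\omega$. Ordinary function symbols $f\colon\iota^\alpha\to\iota$ (constants when $\alpha=0$). Defined $\iota$-symbols $\hat f$ of type $(\omega^{\gamma_1}\to\iota)\times\dots\times(\omega^{\gamma_\alpha}\to\iota)\times\omega^{\beta+1}\to\iota$ ($\gamma_i>0$), partially ordered by an irreflexive, transitive, Noetherian order $<$. The $\iota$-terms $T^\iota$: constants, V-terms, $f(s_1,\dots,s_\alpha)$ with $s_i\in T^\iota$, and $\hat f(X_1,\dots,X_\alpha,t_1,\dots,t_{\beta+1})$ with $X_i$ global variables of type $\omega^{\gamma_i}\to\iota$ and $t_j\in T^\omega$. Each such $\hat f$ has defining equations $\hat f(\vec X,n_1,\dots,n_\beta,\bar 0)=t_B$ and $\hat f(\vec X,n_1,\dots,n_\beta,s(m))=t_S\{Y\leftarrow\hat f(\vec X,n_1,\dots,n_\beta,m)\}$, where $Y$ is a variable of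 type $\iota$, $t_B,t_S$ are $\iota$-terms whose V-terms are over $X_1,\dots,X_\alpha$ (and $t_S$ may contain $Y$), the parameters of $t_B$ are among $n_1,\dots,n_\beta$ and those of $t_S$ among $n_1,\dots,n_\beta,m$, and every defined $\iota$-symbol occurring in $t_B,t_S$ is $<\hat f$ (none if $\hat f$ is minimal). -}

module Defs where

open import Data.Nat using (ℕ; zero; suc; _≤_)
open import Data.Fin using (Fin)
open import Data.Vec using (Vec; []; _∷_; lookup; _[_]≔_)
open import Data.Product using (Σ; _×_; _,_; ∃)
open import Data.Sum using (_⊎_; inj₁; inj₂)
open import Data.Empty using (⊥; ⊥-elim)
open import Data.Unit using (⊤; tt)
open import Function using (flip)
open import Relation.Nullary using (¬_)
open import Relation.Binary.PropositionalEquality using (_≡_)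
open import Induction.WellFounded using (WellFounded)
open import Relation.Binary.Construct.Closure.ReflexiveTransitive using (Star)

-- Sort ω.
-- Defined numeric function symbols given by primitive recursive defining
-- equations: represented by primitive recursive codes of arity k.

data PR : ℕ → Set where
  zeroᶠ : ∀ {k} → PR k
  succᶠ : PR 1
  proj  : ∀ {k} → Fin k → PR k
  comp  : ∀ {k m} → PR m → Vec (PR k) m → PR k
  rec   : ∀ {k} → PR k → PR (suc (suc k)) → PR (suc k)

data Tω (P : Set) : Set where
  𝟘   : Tω P
  par : P → Tω P
  𝕤   : Tω P → Tω P
  app : ∀ {k} → PR k → Vec (Tω P) k → Tω P

mutual
  substω : ∀ {P Q : Set} → (P → Tω Q) → Tω P → Tω Q
  substω σ 𝟘 = 𝟘
  substω σ (par p) = σ p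
  substω σ (𝕤 t) = 𝕤 (substω σ t)
  substω σ (app g ts) = app g (substωs σ ts)

  substωs : ∀ {P Q : Set} {k} → (P → Tω Q) → Vec (Tω P) k → Vec (Tω Q) k
  substωs σ [] = []
  substωs σ (t ∷ ts) = substω σ t ∷ substωs σ ts

record Sig : Set₁ where
  field
    -- ordinary function symbols f : ι^α → ι (constants when α = 0)
    FSym     : Set
    arity    : FSym → ℕ
    -- defined ι-symbols f̂ : (ω^γ₁→ι)×…×(ω^γ_α→ι)×ω^(β+1) → ι
    DSym     : Set
    α        : DSym → ℕ
    γ        : (f : DSym) → Fin (α f) → ℕ
    γ-pos    : ∀ f i → 1 ≤ γ f i
    β        : DSym → ℕ
    _≺_      : DSym → DSym → Set
    ≺-irrefl : ∀ {f} → ¬ (f ≺ f)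
    ≺-trans  : ∀ {f g h} → f ≺ g → g ≺ h → f ≺ h
    ≺-wf     : WellFounded _≺_

module Terms (S : Sig) where
  open Sig S

  -- ι-terms; G g = global variables of type ω^g → ι, P = parameters,
  -- Y = variables of type ι (used only for Y in t_S).
  -- The last argument of dfn is the (β+1)-st ω-argument.
  data Tι (G : ℕ → Set) (P : Set) (Y : Set) : Set where
    var : Y → Tι G P Y
    V   : ∀ {g} → G g → Vec (Tω P) g → Tι G P Y
    fn  : (f : FSym) → Vec (Tι G P Y) (arity f) → Tι G P Y
    dfn : (d : DSym) → ((i : Fin (α d)) → G (γ d i)) →
          Vec (Tω P) (β d) → Tω P → Tι G P Y

  mutual
    AllD : ∀ {G P Y} → (DSym → Set) → Tι G P Y → Set
    AllD Q (var _) = ⊤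
    AllD Q (V _ _) = ⊤
    AllD Q (fn f ts) = AllDs Q ts
    AllD Q (dfn d _ _ _) = Q d

    AllDs : ∀ {G P Y k} → (DSym → Set) → Vec (Tι G P Y) k → Set
    AllDs Q [] = ⊤
    AllDs Q (t ∷ ts) = AllD Q t × AllDs Q ts

  mutual
    inst : ∀ {G G' : ℕ → Set} {P P' Y Y' : Set} →
           (∀ {g} → G g → G' g) → (P → Tω P') → (Y → Tι G' P' Y') →
           Tι G P Y → Tι G' P' Y'
    inst σG σP σY (var y) = σY y
    inst σG σP σY (V x ts) = V (σG x) (substωs σP ts)
    inst σG σP σY (fn f ss) = fn f (insts σG σP σY ss)
    inst σG σP σY (dfn d xs ts t) =
      dfn d (λ i → σG (xs i)) (substωs σP ts) (substω σP t)

    insts : ∀ {G G' : ℕ → Set} {P P' Y Y' : Set} {k} →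
            (∀ {g} → G g → G' g) → (P → Tω P') → (Y → Tι G' P' Y') →
            Vec (Tι G P Y) k → Vec (Tι G' P' Y') k
    insts σG σP σY [] = []
    insts σG σP σY (s ∷ ss) = inst σG σP σY s ∷ insts σG σP σY ss

  -- the local global variables X₁,…,X_α of the defining equations of d
  Loc : DSym → ℕ → Set
  Loc d g = Σ (Fin (α d)) (λ i → γ d i ≡ g)

  Term : Set
  Term = Tι (λ _ → ℕ) ℕ ⊥

-- Defining equations of the defined ι-symbols:
--   f̂(X⃗, n⃗, 0̄)   = t_B
--   f̂(X⃗, n⃗, s(m)) = t_S{Y ← f̂(X⃗, n⃗, m)}
-- Parameters of t_S: inj₁ k = n_k, inj₂ tt = m; ι-variable tt = Y.
record DefEqs (S : Sig) : Set where
  open Sig S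
  open Terms S
  field
    tB : (d : DSym) → Tι (Loc d) (Fin (β d)) ⊥
    tS : (d : DSym) → Tι (Loc d) (Fin (β d) ⊎ ⊤) ⊤
    tB-below : ∀ d → AllD (_≺ d) (tB d)
    tS-below : ∀ d → AllD (_≺ d) (tS d)

module Rewriting (S : Sig) (E : DefEqs S) where
  open Sig S
  open Terms S
  open DefEqs E

  locG : ∀ {d} → ((i : Fin (α d)) → ℕ) → ∀ {g} → Loc d g → ℕ
  locG xs (i , _) = xs i

  bodyP : ∀ {d} → Vec (Tω ℕ) (β d) → Tω ℕ → Fin (β d) ⊎ ⊤ → Tω ℕ
  bodyP ns m (inj₁ k) = lookup ns k
  bodyP ns m (inj₂ _) = m

  data _⟶ᵣ_ : Term → Term → Set where
    base : ∀ d (xs : (i : Fin (α d)) → ℕ) (ns : Vec (Tω ℕ) (β d)) →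
           dfn d xs ns 𝟘 ⟶ᵣ inst (locG xs) (lookup ns) ⊥-elim (tB d)
    step : ∀ d (xs : (i : Fin (α d)) → ℕ) (ns : Vec (Tω ℕ) (β d)) (m : Tω ℕ) →
           dfn d xs ns (𝕤 m) ⟶ᵣ
             inst (locG xs) (bodyP ns m) (λ _ → dfn d xs ns m) (tS d)

  data _⟶_ : Term → Term → Set where
    root : ∀ {s t} → s ⟶ᵣ t → s ⟶ t
    ctx  : ∀ f (ss : Vec Term (arity f)) (i : Fin (arity f)) {u} →
           lookup ss i ⟶ u → fn f ss ⟶ fn f (ss [ i ]≔ u)

R : (S : Sig) → DefEqs S → Terms.Term S → Terms.Term S → Set
R S E = Rewriting._⟶_ S E

Terminating : {A : Set} → (A → A → Set) → Set
Terminating _⟶_ = WellFounded (flip _⟶_)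

Confluent : {A : Set} → (A → A → Set) → Set
Confluent _⟶_ = ∀ {a b c} → Star _⟶_ a b → Star _⟶_ a c →
                ∃ λ d → Star _⟶_ b d × Star _⟶_ c d

Canonical : {A : Set} → (A → A → Set) → Set
Canonical _⟶_ = Terminating _⟶_ × Confluent _⟶_

module Submission where

-- Termination.  Fix a defined symbol d and assume every term headed by a
-- defined symbol below d is strongly normalising.  Then an instantiated
-- right-hand side of a defining equation of d is strongly normalising as
-- soon as the term substituted for Y is: ordinary symbols only rewrite
-- inside their arguments, V-terms are normal forms, and every defined
-- symbol occurring in t_B, t_S lies below d.  Induction on the structure
-- of the last ω-argument (the recursion step replaces s(m) by m) shows that
-- every term headed by d is strongly normalising; well-founded induction on
-- the Noetherian order ≺ removes the hypothesis on d, and a final structural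
-- induction covers all terms.
--
-- Confluence.  Root steps are deterministic and never overlap with steps
-- inside the arguments of an ordinary symbol, and two steps in different
-- arguments commute; so the system is locally confluent, and Newman's lemma
-- (from the standard library) turns termination and local confluence into
-- confluence.

open import Defs
open import Data.Nat using (ℕ)
open import Data.Fin using (Fin; zero; suc; _≟_)
open import Data.Vec using (Vec; []; _∷_; lookup; _[_]≔_)
open import Data.Vec.Properties using ([]≔-idempotent; []≔-commutes; lookup∘update; lookup∘update′)
open import Data.Product using (_,_)
open import Data.Empty using (⊥-elim)
open import Function using (flip)
open import Relation.Nullary using (yes; no)
open import Relation.Binary.PropositionalEquality using (_≢_; refl; sym; subst; ≢-sym)
open import Induction.WellFounded using (WellFounded; Acc; acc; module Subrelation)
open import Relation.Binary.Construct.Closure.ReflexiveTransitive using (Star; ε; _◅_; gmap)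
open import Relation.Binary.Construct.Closure.Transitive as Transitive using (Plus; TransClosure; [_]; _∼⁺⟨_⟩_; _++_)
open import Relation.Binary.Rewriting using (WeaklyConfluent; sn&wcr⇒cr)

-- A terminating relation has a terminating transitive closure; this is
-- the form of termination that Newman's lemma asks for.
terminating-plus : {A : Set} {_⟶_ : A → A → Set} →
                   Terminating _⟶_ → WellFounded (flip (Plus _⟶_))
terminating-plus {_⟶_ = _⟶_} wf =
  Subrelation.wellFounded reverse (Transitive.wellFounded (flip _⟶_) wf)
  where
    reverse : ∀ {a b} → Plus _⟶_ b a → TransClosure (flip _⟶_) a b
    reverse [ r ] = [ r ]
    reverse (_ ∼⁺⟨ p ⟩ q) = reverse q ++ reverse p

module VectorSteps {A : Set} (_⟶_ : A → A → Set) where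

  data _⟶ᵛ_ : ∀ {k} → Vec A k → Vec A k → Set where
    here  : ∀ {k a a'} {as : Vec A k} → a ⟶ a' → (a ∷ as) ⟶ᵛ (a' ∷ as)
    there : ∀ {k a} {as as' : Vec A k} → as ⟶ᵛ as' → (a ∷ as) ⟶ᵛ (a ∷ as')

  update-step : ∀ {k} (as : Vec A k) i {a} → lookup as i ⟶ a → as ⟶ᵛ (as [ i ]≔ a)
  update-step (_ ∷ as) zero    r = here r
  update-step (_ ∷ as) (suc i) r = there (update-step as i r)

  acc-[] : Acc (flip _⟶ᵛ_) []
  acc-[] = acc λ ()

  acc-∷ : ∀ {a k} {as : Vec A k} → Acc (flip _⟶_) a → Acc (flip _⟶ᵛ_) as →
          Acc (flip _⟶ᵛ_) (a ∷ as)
  acc-∷ (acc ra) (acc ras) = acc λ { (here r)   → acc-∷ (ra r) (acc ras)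
                                   ; (there r) → acc-∷ (acc ra) (ras r) }

module Canonicity (S : Sig) (E : DefEqs S) where
  open Sig S
  open Terms S
  open DefEqs E
  open Rewriting S E
  open VectorSteps _⟶_

  SN : Term → Set
  SN = Acc (flip _⟶_)

  SNᵛ : ∀ {k} → Vec Term k → Set
  SNᵛ = Acc (flip _⟶ᵛ_)

  sn-V : ∀ {g} (x : ℕ) (ts : Vec (Tω ℕ) g) → SN (V x ts)
  sn-V x ts = acc λ { (root ()) }

  sn-fn : ∀ f {ss : Vec Term (arity f)} → SNᵛ ss → SN (fn f ss)
  sn-fn f {ss} (acc rs) =
    acc λ { (root ())
          ; (ctx .f .ss i r) → sn-fn f (rs (update-step ss i r)) }

  SN-below : (DSym → Set) → Set
  SN-below Q = ∀ d' → Q d' → ∀ xs ns t → SN (dfn d' xs ns t)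

  module _ {Q : DSym → Set} (sn-Q : SN-below Q)
           {G : ℕ → Set} {P Y : Set} (σG : ∀ {g} → G g → ℕ) (σP : P → Tω ℕ)
           (σY : Y → Term) (sn-σY : ∀ y → SN (σY y)) where
    mutual
      sn-inst : (u : Tι G P Y) → AllD Q u → SN (inst σG σP σY u)
      sn-inst (var y)          _  = sn-σY y
      sn-inst (V x ts)         _  = sn-V (σG x) (substωs σP ts)
      sn-inst (fn f ss)        qs = sn-fn f (sn-insts ss qs)
      sn-inst (dfn d' xs ts t) q  = sn-Q d' q _ _ _

      sn-insts : ∀ {k} (us : Vec (Tι G P Y) k) → AllDs Q us → SNᵛ (insts σG σP σY us)
      sn-insts []       _        = acc-[]
      sn-insts (u ∷ us) (q , qs) = acc-∷ (sn-inst u q) (sn-insts us qs)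

  sn-dfn-step : ∀ d → SN-below (_≺ d) → ∀ xs ns t → SN (dfn d xs ns t)
  sn-dfn-step d below xs ns 𝟘 = acc λ { (root (base .d .xs .ns)) →
    sn-inst below (locG xs) (lookup ns) ⊥-elim (λ ()) (tB d) (tB-below d) }
  sn-dfn-step d below xs ns (𝕤 m) = acc λ { (root (step .d .xs .ns .m)) →
    sn-inst below (locG xs) (bodyP ns m) (λ _ → dfn d xs ns m)
            (λ _ → sn-dfn-step d below xs ns m) (tS d) (tS-below d) }
  sn-dfn-step _ _ _ _ (par _)   = acc λ { (root ()) }
  sn-dfn-step _ _ _ _ (app _ _) = acc λ { (root ()) }

  sn-dfn : ∀ d xs ns t → SN (dfn d xs ns t)
  sn-dfn d = go d (≺-wf d)
    where
      go : ∀ d → Acc _≺_ d → ∀ xs ns t → SN (dfn d xs ns t)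
      go d (acc rs) = sn-dfn-step d (λ d' d'≺d → go d' (rs d'≺d))

  mutual
    terminating : Terminating _⟶_
    terminating (var ())
    terminating (V x ts)        = sn-V x ts
    terminating (fn f ss)       = sn-fn f (terminatingᵛ ss)
    terminating (dfn d xs ns t) = sn-dfn d xs ns t

    terminatingᵛ : ∀ {k} (ss : Vec Term k) → SNᵛ ss
    terminatingᵛ []       = acc-[]
    terminatingᵛ (s ∷ ss) = acc-∷ (terminating s) (terminatingᵛ ss)

  module _ (f : FSym) (ss : Vec Term (arity f)) (i : Fin (arity f)) where
    plug : Term → Term
    plug u = fn f (ss [ i ]≔ u)

    plug-step : ∀ {u v} → u ⟶ v → plug u ⟶ plug v
    plug-step {u} {v} r =
      subst (λ ts → plug u ⟶ fn f ts) ([]≔-idempotent ss i)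
        (ctx f (ss [ i ]≔ u) i (subst (_⟶ v) (sym (lookup∘update i ss u)) r))

    plug-steps : ∀ {u v} → Star _⟶_ u v → Star _⟶_ (plug u) (plug v)
    plug-steps = gmap plug plug-step

  step-elsewhere : ∀ f (ss : Vec Term (arity f)) {i j} → i ≢ j → ∀ {u v} →
                   lookup ss j ⟶ v → fn f (ss [ i ]≔ u) ⟶ fn f ((ss [ i ]≔ u) [ j ]≔ v)
  step-elsewhere f ss {i} {j} i≢j {u} {v} r =
    ctx f (ss [ i ]≔ u) j (subst (_⟶ v) (sym (lookup∘update′ (≢-sym i≢j) ss u)) r)

  -- There are no critical pairs: root steps are deterministic, steps in the
  -- same argument are joined by induction, and steps in different arguments
  -- commute.
  locally-confluent : WeaklyConfluent _⟶_
  locally-confluent (root (base d xs ns))   (root (base .d .xs .ns))   = _ , ε , ε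
  locally-confluent (root (step d xs ns m)) (root (step .d .xs .ns .m)) = _ , ε , ε
  locally-confluent (ctx f ss i r₁) (ctx .f .ss j r₂) with i ≟ j
  ... | yes refl with locally-confluent r₁ r₂
  ...   | _ , p₁ , p₂ = _ , plug-steps f ss i p₁ , plug-steps f ss i p₂
  locally-confluent (ctx f ss i {u} r₁) (ctx .f .ss j {v} r₂) | no i≢j =
    _ , step-elsewhere f ss i≢j r₂ ◅ ε ,
        subst (λ ts → fn f (ss [ j ]≔ v) ⟶ fn f ts) ([]≔-commutes ss j i (≢-sym i≢j))
              (step-elsewhere f ss (≢-sym i≢j) r₁) ◅ ε

  confluent : Confluent _⟶_
  confluent = sn&wcr⇒cr (terminating-plus terminating) locally-confluent

proposition2 : (S : Sig) (E : DefEqs S) → Canonical (R S E)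
proposition2 S E = terminating , confluent
  where open Canonicity S E
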